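{- Let $\Gamma$ be a semicomplete multipartite commutative weakly distance-regular digraph. If $(2,s)\in\tilde\partial(\Gamma)$, then $s\in\{1,2\}$.
   Context: A digraph has a finite vertex set and arcs that are ordered pairs of distinct vertices. $\partial(x,y)$ is the length of a shortest directed path from $x$ to $y$; strongly connected means all are finite. $\tilde\partial(x,y)=(\partial(x,y),\partial(y,x))$, $\tilde\partial(\Gamma)$ the set of these pairs, $\Gamma_{\tilde i}=\{(x,y):\tilde\partial(x,y)=\tilde i\}$. A strongly connected $\Gamma$ is weakly distance-regular if its arc relation is not symmetric and for all $\tilde i,\tilde j,\tilde h\in\tilde\partial(\Gamma)$ the number $|\{z:(x,z)\in\Gamma_{\tilde i},(z,y)\in\Gamma_{\tilde j}\}|$ is the same for all $(x,y)\in\Gamma_{\tilde h}$; commutative if this number is symmetric in $\tilde i,\tilde j$. $\Gamma$ is semicomplete multipartite if its underlying graph ($x\sim y$ iff $(x,y)$ or $(y,x)$ is an arc) is a complete multipartite graph with at least 2 parts, each of size at least 2. -}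

module Defs where

open import Data.Nat using (ℕ; zero; suc; _<_; _≤_)
open import Data.Nat.Properties using (_≟_)
open import Data.Bool using (Bool; true; false; _∧_; T)
open import Data.Fin using (Fin)
import Data.Fin.Properties as FinP
open import Data.List using (List; length; filter)
open import Data.Bool.ListAction using (any)
open import Data.List.Base using ()
open import Data.Fin.Base using ()
open import Data.List using (allFin)
open import Data.Product using (Σ; ∃; _×_; _,_)
open import Data.Product.Properties using (≡-dec)
open import Relation.Nullary using (¬_; Dec; yes; no)
open import Relation.Nullary.Decidable using (⌊_⌋; _×-dec_)
open import Relation.Binary.PropositionalEquality using (_≡_; _≢_)

record Digraph (n : ℕ) : Set where
  field
    arc   : Fin n → Fin n → Bool
    loopless : ∀ x → arc x x ≡ false
open Digraph public

module _ {n : ℕ} (Γ : Digraph n) where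

  walkB : ℕ → Fin n → Fin n → Bool
  walkB zero    x y = ⌊ x FinP.≟ y ⌋
  walkB (suc k) x y = any (λ z → arc Γ x z ∧ walkB k z y) (allFin n)

  search : ℕ → ℕ → Fin n → Fin n → ℕ
  search k zero       x y = k
  search k (suc fuel) x y with walkB k x y
  ... | true  = k
  ... | false = search (suc k) fuel x y

  -- A shortest walk is
  -- a path, hence has length < n; if y is unreachable from x the value is n
  -- (a stand-in for ∞, only ever used for strongly connected digraphs).
  ∂ : Fin n → Fin n → ℕ
  ∂ x y = search 0 n x y

  ∂̃ : Fin n → Fin n → ℕ × ℕ
  ∂̃ x y = (∂ x y , ∂ y x)

  In∂̃ : ℕ × ℕ → Set
  In∂̃ h = ∃ λ x → ∃ λ y → ∂̃ x y ≡ h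

  StronglyConnected : Set
  StronglyConnected = ∀ x y → ∃ λ k → walkB k x y ≡ true

  count : ℕ × ℕ → ℕ × ℕ → Fin n → Fin n → ℕ
  count i j x y =
    length (filter (λ z → ≡-dec _≟_ _≟_ (∂̃ x z) i ×-dec ≡-dec _≟_ _≟_ (∂̃ z y) j) (allFin n))

  ArcNotSymmetric : Set
  ArcNotSymmetric = ∃ λ x → ∃ λ y → (arc Γ x y ≡ true) × (arc Γ y x ≡ false)

  WeaklyDistanceRegular : Set
  WeaklyDistanceRegular =
    StronglyConnected × ArcNotSymmetric ×
    (∀ i j h → In∂̃ i → In∂̃ j → In∂̃ h →
      ∀ x y x' y' → ∂̃ x y ≡ h → ∂̃ x' y' ≡ h → count i j x y ≡ count i j x' y')

  Commutative : Set
  Commutative =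
    ∀ i j h → In∂̃ i → In∂̃ j → In∂̃ h →
      ∀ x y → ∂̃ x y ≡ h → count i j x y ≡ count j i x y

  Adj : Fin n → Fin n → Set
  Adj x y = T (arc Γ x y) Data.Sum.⊎ T (arc Γ y x)
    where import Data.Sum

  -- underlying graph is complete multipartite with m ≥ 2 parts, each of size ≥ 2:
  -- a surjective part-assignment such that distinct vertices are adjacent
  -- iff they lie in different parts.
  SemicompleteMultipartite : Set
  SemicompleteMultipartite =
    Σ ℕ λ m → Σ (Fin n → Fin m) λ part →
      (2 ≤ m) ×
      (∀ (p : Fin m) → ∃ λ x → ∃ λ y → x ≢ y × part x ≡ p × part y ≡ p) ×
      (∀ x y → x ≢ y → (Adj x y → part x ≢ part y) × (part x ≢ part y → Adj x y))

{-# OPTIONS --safe #-}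
-- Suppose ∂(x,y) = 2 but ∂(y,x) ≥ 3. Then x and y are non-adjacent, hence in the same part;
-- an out-neighbour z of y lies in another part, so it is adjacent to x, and z → x would give
-- the path y → z → x; hence N⁺(y) ⊆ N⁺(x). Weak distance-regularity at h = (0,0) makes the
-- multiset {∂̃(v,z) : z} independent of v, so |N⁺(x)| = |N⁺(y)| and N⁺(x) = N⁺(y). The middle
-- vertex w of x → w → y is then a two-way neighbour of y, so x has a two-way neighbour z as well,
-- and z ∈ N⁺(y) yields y → z → x.
module Submission where

open import Defs
open import Data.Nat using (ℕ; zero; suc; _+_; _≤_; _<_; z≤n; s≤s)
open import Data.Nat.Properties
  using (_≟_; ≤-trans; ≤-reflexive; m≤m+n; +-suc; +-identityʳ; ≤∧≢⇒<; <-irrefl; <⇒≱;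
         n≤0⇒n≡0; n≤1+n; suc-injective; 0≢1+n)
open import Data.Bool using (true; false; _∧_; T)
open import Data.Bool.Properties using (T-∧)
open import Data.Fin using (Fin)
import Data.Fin.Properties as Fin
open import Data.List using (List; []; _∷_; _++_; length; filter; map; allFin)
open import Data.List.Properties using (length-map; filter-≐; filter-accept; filter-none)
open import Data.List.Membership.Propositional using (_∈_; _∉_; lose)
open import Data.List.Membership.Propositional.Properties
  using (∈-allFin; ∈-map⁺; ∈-map⁻; ∈-filter⁺; ∈-filter⁻; ∈-∃++)
open import Data.List.Relation.Unary.Any using (satisfied)
open import Data.List.Relation.Unary.Any.Properties using (any⁺; any⁻)
open import Data.List.Relation.Unary.All.Properties using (¬Any⇒All¬)
open import Data.List.Relation.Binary.Pointwise using (Pointwise-≡⇒≡)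
open import Data.List.Relation.Binary.Sublist.Propositional using (⊆-refl)
open import Data.List.Relation.Binary.Sublist.Propositional.Properties using (filter⁺; to-≋)
open import Data.List.Relation.Binary.Permutation.Propositional
  using (_↭_; ↭-refl; ↭-sym; ↭-trans; prep)
open import Data.List.Relation.Binary.Permutation.Propositional.Properties
  using (↭-length; filter-↭; shift; ∈-resp-↭)
open import Data.Product using (∃; _×_; _,_; proj₁; proj₂; swap)
open import Data.Product.Properties using (≡-dec)
open import Data.Sum using (_⊎_; inj₁; inj₂; [_,_]′)
open import Data.Empty using (⊥; ⊥-elim)
open import Function using (_∘_; Equivalence)
open import Relation.Nullary using (¬_; yes; no; does; contradiction)
open import Relation.Nullary.Decidable using (toWitness; fromWitness; decidable-stable; _×-dec_)
open import Relation.Unary using (Decidable; _≐_)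
open import Relation.Binary.Definitions using (DecidableEquality)
open import Relation.Binary.PropositionalEquality
  using (_≡_; _≢_; refl; sym; trans; cong; cong₂; subst; module ≡-Reasoning)

module _ {A : Set} where

  filter-map : ∀ {B : Set} {P : B → Set} (P? : Decidable P) (f : A → B) (xs : List A) →
               filter P? (map f xs) ≡ map f (filter (P? ∘ f) xs)
  filter-map P? f [] = refl
  filter-map P? f (x ∷ xs) with does (P? (f x))
  ... | true  = cong (f x ∷_) (filter-map P? f xs)
  ... | false = filter-map P? f xs

  length-filter-map : ∀ {B : Set} {P : B → Set} (P? : Decidable P) (f : A → B) (xs : List A) →
                      length (filter P? (map f xs)) ≡ length (filter (P? ∘ f) xs)
  length-filter-map P? f xs = trans (cong length (filter-map P? f xs)) (length-map f (filter (P? ∘ f) xs))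

  module _ {P : A → Set} (P? : Decidable P) where

    length-filter-↭ : ∀ {xs ys} → xs ↭ ys → length (filter P? xs) ≡ length (filter P? ys)
    length-filter-↭ = ↭-length ∘ filter-↭ P?

    length-filter-∷-cancel : ∀ {x xs ys} → length (filter P? (x ∷ xs)) ≡ length (filter P? (x ∷ ys)) →
                             length (filter P? xs) ≡ length (filter P? ys)
    length-filter-∷-cancel {x} eq with does (P? x)
    ... | true  = suc-injective eq
    ... | false = eq

    -- A sublist of the same length is the whole list.
    ⊇-of-length-filter : ∀ {Q : A → Set} (Q? : Decidable Q) {xs} → (∀ {z} → P z → Q z) →
                         length (filter P? xs) ≡ length (filter Q? xs) →
                         ∀ {z} → z ∈ xs → Q z → P z
    ⊇-of-length-filter Q? {xs} P⊆Q eq {z} z∈xs qz =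
      proj₂ (∈-filter⁻ P? {xs = xs} (subst (z ∈_) (sym filters-equal) (∈-filter⁺ Q? z∈xs qz)))
      where
      filters-equal : filter P? xs ≡ filter Q? xs
      filters-equal = Pointwise-≡⇒≡ (to-≋ eq (filter⁺ P? Q? (λ { refl → P⊆Q }) (⊆-refl {x = xs})))

module Multiplicity {A : Set} (_≟ᴬ_ : DecidableEquality A) where

  open import Data.List.Membership.DecPropositional _≟ᴬ_ using (_∈?_)

  multiplicity : A → List A → ℕ
  multiplicity c xs = length (filter (c ≟ᴬ_) xs)

  multiplicity-head : ∀ x xs → multiplicity x (x ∷ xs) ≡ suc (multiplicity x xs)
  multiplicity-head x xs = cong length (filter-accept (x ≟ᴬ_) refl)

  multiplicity-∉ : ∀ {c xs} → c ∉ xs → multiplicity c xs ≡ 0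
  multiplicity-∉ {c} {xs} c∉xs = cong length (filter-none (c ≟ᴬ_) (¬Any⇒All¬ xs c∉xs))

  ↭-of-multiplicities : ∀ xs ys → (∀ c → multiplicity c xs ≡ multiplicity c ys) → xs ↭ ys
  ↭-of-multiplicities []       []       _    = ↭-refl
  ↭-of-multiplicities []       (y ∷ ys) same = contradiction (trans (same y) (multiplicity-head y ys)) 0≢1+n
  ↭-of-multiplicities (x ∷ xs) ys       same with x ∈? ys
  ... | no x∉ys =
    contradiction (trans (sym (multiplicity-head x xs)) (trans (same x) (multiplicity-∉ x∉ys))) (0≢1+n ∘ sym)
  ... | yes x∈ys with us , vs , refl ← ∈-∃++ x∈ys =
    ↭-trans (prep x (↭-of-multiplicities xs (us ++ vs) same′)) (↭-sym (shift x us vs))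
    where
    same′ : ∀ c → multiplicity c xs ≡ multiplicity c (us ++ vs)
    same′ c = length-filter-∷-cancel (c ≟ᴬ_) (trans (same c) (length-filter-↭ (c ≟ᴬ_) (shift x us vs)))

module _ {n : ℕ} (Γ : Digraph n) where

  search-≤-fuel : ∀ k fuel x y → search Γ k fuel x y ≤ k + fuel
  search-≤-fuel k zero       x y = ≤-reflexive (sym (+-identityʳ k))
  search-≤-fuel k (suc fuel) x y with walkB Γ k x y
  ... | true  = m≤m+n k (suc fuel)
  ... | false = subst (search Γ (suc k) fuel x y ≤_) (sym (+-suc k fuel)) (search-≤-fuel (suc k) fuel x y)

  search-≤-walk : ∀ fuel {k₀ k x y} → k₀ ≤ k → T (walkB Γ k x y) → search Γ k₀ fuel x y ≤ k
  search-≤-walk zero       k₀≤k _ = k₀≤k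
  search-≤-walk (suc fuel) {k₀} {k} {x} {y} k₀≤k walk with walkB Γ k₀ x y in e
  ... | true  = k₀≤k
  ... | false = search-≤-walk fuel (≤∧≢⇒< k₀≤k k₀≢k) walk
    where
    k₀≢k : k₀ ≢ k
    k₀≢k refl = subst T e walk

  search-walk : ∀ fuel k₀ x y → search Γ k₀ fuel x y < k₀ + fuel →
                T (walkB Γ (search Γ k₀ fuel x y) x y)
  search-walk zero       k₀ x y lt = contradiction lt (<-irrefl (sym (+-identityʳ k₀)))
  search-walk (suc fuel) k₀ x y lt with walkB Γ k₀ x y in e
  ... | true  = subst T (sym e) _
  ... | false = search-walk fuel (suc k₀) x y (subst (search Γ (suc k₀) fuel x y <_) (+-suc k₀ fuel) lt)

  ∂≤n : ∀ x y → ∂ Γ x y ≤ n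
  ∂≤n = search-≤-fuel 0 n

  ∂-minimal : ∀ {k x y} → T (walkB Γ k x y) → ∂ Γ x y ≤ k
  ∂-minimal = search-≤-walk n z≤n

  ∂-walk : ∀ {k x y} → ∂ Γ x y ≡ k → k < n → T (walkB Γ k x y)
  ∂-walk {x = x} {y} refl = search-walk n 0 x y

  walk-zero⁺ : ∀ x → T (walkB Γ 0 x x)
  walk-zero⁺ x = fromWitness {a? = x Fin.≟ x} refl

  walk-zero⁻ : ∀ {x y} → T (walkB Γ 0 x y) → x ≡ y
  walk-zero⁻ {x} {y} = toWitness {a? = x Fin.≟ y}

  walk-suc⁺ : ∀ {k x y} z → T (arc Γ x z) → T (walkB Γ k z y) → T (walkB Γ (suc k) x y)
  walk-suc⁺ {k} {x} {y} z xz zy =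
    any⁺ (λ z → arc Γ x z ∧ walkB Γ k z y) (lose (∈-allFin z) (Equivalence.from T-∧ (xz , zy)))

  walk-suc⁻ : ∀ {k x y} → T (walkB Γ (suc k) x y) → ∃ λ z → T (arc Γ x z) × T (walkB Γ k z y)
  walk-suc⁻ {k} {x} {y} walk
    with z , xzy ← satisfied (any⁻ (λ z → arc Γ x z ∧ walkB Γ k z y) (allFin n) walk)
    = z , Equivalence.to T-∧ xzy

  arc⇒walk₁ : ∀ {x y} → T (arc Γ x y) → T (walkB Γ 1 x y)
  arc⇒walk₁ {x} {y} xy = walk-suc⁺ {0} {x} {y} y xy (walk-zero⁺ y)

  walk₁⇒arc : ∀ {x y} → T (walkB Γ 1 x y) → T (arc Γ x y)
  walk₁⇒arc {x} {y} walk with z , xz , zy ← walk-suc⁻ {0} {x} {y} walk =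
    subst (T ∘ arc Γ x) (walk-zero⁻ {z} {y} zy) xz

  ∂-refl : ∀ x → ∂ Γ x x ≡ 0
  ∂-refl x = n≤0⇒n≡0 (∂-minimal (walk-zero⁺ x))

  ∂≡0⇒≡ : ∀ {x y} → ∂ Γ x y ≡ 0 → x ≡ y
  ∂≡0⇒≡ {x} eq = walk-zero⁻ (∂-walk eq (≤-trans (s≤s z≤n) (Fin.toℕ<n x)))

  ∂≡suc⇒≢ : ∀ {x y k} → ∂ Γ x y ≡ suc k → x ≢ y
  ∂≡suc⇒≢ {x} eq refl = 0≢1+n (trans (sym (∂-refl x)) eq)

  arc⇒∂≡1 : ∀ {x y} → T (arc Γ x y) → ∂ Γ x y ≡ 1
  arc⇒∂≡1 {x} {y} xy with ∂ Γ x y in e | ∂-minimal {1} {x} {y} (arc⇒walk₁ xy)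
  ... | 0           | _           with refl ← ∂≡0⇒≡ e = contradiction (subst T (loopless Γ x) xy) λ ()
  ... | 1           | _           = refl
  ... | suc (suc _) | s≤s ()

  ∂≡1⇒arc : ∀ {x y} → ∂ Γ x y ≡ 1 → 1 < n → T (arc Γ x y)
  ∂≡1⇒arc eq 1<n = walk₁⇒arc (∂-walk eq 1<n)

  ∂≡2⇒path : ∀ {x y} → ∂ Γ x y ≡ 2 → 2 < n → ∃ λ w → T (arc Γ x w) × T (arc Γ w y)
  ∂≡2⇒path {x} {y} eq 2<n with w , xw , wy ← walk-suc⁻ {1} {x} {y} (∂-walk eq 2<n) =
    w , xw , walk₁⇒arc wy

  path⇒∂≤2 : ∀ {x z y} → T (arc Γ x z) → T (arc Γ z y) → ∂ Γ x y ≤ 2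
  path⇒∂≤2 {x} {z} {y} xz zy = ∂-minimal (walk-suc⁺ {1} {x} {y} z xz (arc⇒walk₁ zy))

  private
    _≟ₚ_ : DecidableEquality (ℕ × ℕ)
    _≟ₚ_ = ≡-dec _≟_ _≟_

  open Multiplicity _≟ₚ_
  open import Data.List.Membership.DecPropositional _≟ₚ_ using (_∈?_)

  profile : Fin n → List (ℕ × ℕ)
  profile v = map (∂̃ Γ v) (allFin n)

  ∂̃-refl : ∀ v → ∂̃ Γ v v ≡ (0 , 0)
  ∂̃-refl v = cong (λ d → d , d) (∂-refl v)

  In∂̃-swap : ∀ {c} → In∂̃ Γ c → In∂̃ Γ (swap c)
  In∂̃-swap (x , y , eq) = y , x , cong swap eq

  In∂̃-of-∈profile : ∀ {c v} → c ∈ profile v → In∂̃ Γ c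
  In∂̃-of-∈profile {v = v} c∈ with z , _ , c≡ ← ∈-map⁻ (∂̃ Γ v) c∈ = v , z , sym c≡

  count-diagonal : ∀ c v → count Γ c (swap c) v v ≡ multiplicity c (profile v)
  count-diagonal c v = begin
    length (filter (λ z → (∂̃ Γ v z ≟ₚ c) ×-dec (∂̃ Γ z v ≟ₚ swap c)) (allFin n))
      ≡⟨ cong length (filter-≐ _ ((c ≟ₚ_) ∘ ∂̃ Γ v) same-condition (allFin n)) ⟩
    length (filter ((c ≟ₚ_) ∘ ∂̃ Γ v) (allFin n))
      ≡⟨ length-filter-map (c ≟ₚ_) (∂̃ Γ v) (allFin n) ⟨
    multiplicity c (profile v) ∎
    where
    open ≡-Reasoning
    same-condition : (λ z → ∂̃ Γ v z ≡ c × ∂̃ Γ z v ≡ swap c) ≐ (λ z → c ≡ ∂̃ Γ v z)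
    same-condition = (λ (≡c , _) → sym ≡c) , λ c≡ → sym c≡ , cong swap (sym c≡)

  module _ (wdr : WeaklyDistanceRegular Γ) where

    multiplicity-profile-of-In∂̃ : ∀ {c} → In∂̃ Γ c → ∀ v v′ →
                                  multiplicity c (profile v) ≡ multiplicity c (profile v′)
    multiplicity-profile-of-In∂̃ {c} c∈∂̃ v v′ = begin
      multiplicity c (profile v)   ≡⟨ count-diagonal c v ⟨
      count Γ c (swap c) v v       ≡⟨ proj₂ (proj₂ wdr) c (swap c) (0 , 0)
                                        c∈∂̃ (In∂̃-swap c∈∂̃) (v , v , ∂̃-refl v)
                                        v v v′ v′ (∂̃-refl v) (∂̃-refl v′) ⟩
      count Γ c (swap c) v′ v′     ≡⟨ count-diagonal c v′ ⟩
      multiplicity c (profile v′)  ∎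
      where open ≡-Reasoning

    multiplicity-profile : ∀ c v v′ → multiplicity c (profile v) ≡ multiplicity c (profile v′)
    multiplicity-profile c v v′ with c ∈? profile v | c ∈? profile v′
    ... | yes c∈ | _      = multiplicity-profile-of-In∂̃ (In∂̃-of-∈profile c∈) v v′
    ... | no _   | yes c∈ = multiplicity-profile-of-In∂̃ (In∂̃-of-∈profile c∈) v v′
    ... | no c∉  | no c∉′ = trans (multiplicity-∉ c∉) (sym (multiplicity-∉ c∉′))

    profile-↭ : ∀ v v′ → profile v ↭ profile v′
    profile-↭ v v′ = ↭-of-multiplicities (profile v) (profile v′) (λ c → multiplicity-profile c v v′)

    ∂̃-realised-everywhere : ∀ {v z c} v′ → ∂̃ Γ v z ≡ c → ∃ λ z′ → ∂̃ Γ v′ z′ ≡ c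
    ∂̃-realised-everywhere {v} {z} v′ refl
      with z′ , _ , ≡∂̃ ← ∈-map⁻ (∂̃ Γ v′)
                           (∈-resp-↭ (profile-↭ v v′) (∈-map⁺ (∂̃ Γ v) (∈-allFin z)))
      = z′ , sym ≡∂̃

    length-filter-∂̃ : ∀ {P : ℕ × ℕ → Set} (P? : Decidable P) v v′ →
                      length (filter (P? ∘ ∂̃ Γ v) (allFin n)) ≡
                      length (filter (P? ∘ ∂̃ Γ v′) (allFin n))
    length-filter-∂̃ P? v v′ = begin
      length (filter (P? ∘ ∂̃ Γ v) (allFin n))   ≡⟨ length-filter-map P? (∂̃ Γ v) (allFin n) ⟨
      length (filter P? (profile v))            ≡⟨ length-filter-↭ P? (profile-↭ v v′) ⟩
      length (filter P? (profile v′))           ≡⟨ length-filter-map P? (∂̃ Γ v′) (allFin n) ⟩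
      length (filter (P? ∘ ∂̃ Γ v′) (allFin n))  ∎
      where open ≡-Reasoning

module NoLongReturn {n m} (Γ : Digraph n) (part : Fin n → Fin m)
    (multipartite : ∀ x y → x ≢ y → (Adj Γ x y → part x ≢ part y) × (part x ≢ part y → Adj Γ x y))
    (wdr : WeaklyDistanceRegular Γ) {x y : Fin n} (∂xy≡2 : ∂ Γ x y ≡ 2) (3≤∂yx : 3 ≤ ∂ Γ y x) where

  2<n : 2 < n
  2<n = ≤-trans 3≤∂yx (∂≤n Γ y x)

  1<n : 1 < n
  1<n = ≤-trans (n≤1+n 2) 2<n

  no-return-path : ∀ {z} → T (arc Γ y z) → ¬ T (arc Γ z x)
  no-return-path yz zx = <⇒≱ 3≤∂yx (path⇒∂≤2 Γ yz zx)

  not-adjacent : ¬ Adj Γ x y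
  not-adjacent (inj₁ xy) = contradiction (trans (sym (arc⇒∂≡1 Γ xy)) ∂xy≡2) λ ()
  not-adjacent (inj₂ yx) = <⇒≱ 3≤∂yx (≤-trans (≤-reflexive (arc⇒∂≡1 Γ yx)) (n≤1+n 1))

  same-part : part x ≡ part y
  same-part = decidable-stable (part x Fin.≟ part y)
                (not-adjacent ∘ proj₂ (multipartite x y (∂≡suc⇒≢ Γ ∂xy≡2)))

  out-neighbour-of-y⇒of-x : ∀ {z} → ∂ Γ y z ≡ 1 → ∂ Γ x z ≡ 1
  out-neighbour-of-y⇒of-x {z} ∂yz≡1 =
    [ arc⇒∂≡1 Γ , ⊥-elim ∘ no-return-path yz ]′ (proj₂ (multipartite x z x≢z) px≢pz)
    where
    yz : T (arc Γ y z)
    yz = ∂≡1⇒arc Γ ∂yz≡1 1<n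
    py≢pz : part y ≢ part z
    py≢pz = proj₁ (multipartite y z (∂≡suc⇒≢ Γ ∂yz≡1)) (inj₁ yz)
    px≢pz : part x ≢ part z
    px≢pz = py≢pz ∘ trans (sym same-part)
    x≢z : x ≢ z
    x≢z = px≢pz ∘ cong part

  out-neighbour-of-x⇒of-y : ∀ {z} → ∂ Γ x z ≡ 1 → ∂ Γ y z ≡ 1
  out-neighbour-of-x⇒of-y {z} =
    ⊇-of-length-filter (λ z → ∂ Γ y z ≟ 1) (λ z → ∂ Γ x z ≟ 1) out-neighbour-of-y⇒of-x
      (length-filter-∂̃ Γ wdr ((_≟ 1) ∘ proj₁) y x) (∈-allFin z)

  no-two-way-neighbour-of-x : ∀ {z} → ∂̃ Γ x z ≢ (1 , 1)
  no-two-way-neighbour-of-x ∂̃xz≡11 =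
    no-return-path (∂≡1⇒arc Γ (out-neighbour-of-x⇒of-y (cong proj₁ ∂̃xz≡11)) 1<n)
                   (∂≡1⇒arc Γ (cong proj₂ ∂̃xz≡11) 1<n)

  two-way-neighbour-of-y : ∃ λ w → ∂̃ Γ y w ≡ (1 , 1)
  two-way-neighbour-of-y with w , xw , wy ← ∂≡2⇒path Γ ∂xy≡2 2<n =
    w , cong₂ _,_ (out-neighbour-of-x⇒of-y (arc⇒∂≡1 Γ xw)) (arc⇒∂≡1 Γ wy)

  absurd : ⊥
  absurd with _ , ∂̃yw≡11 ← two-way-neighbour-of-y =
    no-two-way-neighbour-of-x (proj₂ (∂̃-realised-everywhere Γ wdr x ∂̃yw≡11))

return-distance-of-2 : ∀ {n} (Γ : Digraph n) → SemicompleteMultipartite Γ → WeaklyDistanceRegular Γ →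
                       ∀ {x y} → ∂ Γ x y ≡ 2 → ∂ Γ y x ≡ 1 ⊎ ∂ Γ y x ≡ 2
return-distance-of-2 Γ (_ , part , _ , _ , multipartite) wdr {x} {y} ∂xy≡2 with ∂ Γ y x in ∂yx≡
... | 0                 = ⊥-elim (∂≡suc⇒≢ Γ ∂xy≡2 (sym (∂≡0⇒≡ Γ ∂yx≡)))
... | 1                 = inj₁ refl
... | 2                 = inj₂ refl
... | suc (suc (suc _)) =
  ⊥-elim (NoLongReturn.absurd Γ part multipartite wdr ∂xy≡2
           (subst (3 ≤_) (sym ∂yx≡) (s≤s (s≤s (s≤s z≤n)))))

lemma4p7 : ∀ {n} (Γ : Digraph n) → SemicompleteMultipartite Γ → WeaklyDistanceRegular Γ →
             Commutative Γ → ∀ (s : ℕ) → In∂̃ Γ (2 , s) → s ≡ 1 ⊎ s ≡ 2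
lemma4p7 Γ scm wdr _ s (x , y , ∂̃xy≡2s) =
  subst (λ t → t ≡ 1 ⊎ t ≡ 2) (cong proj₂ ∂̃xy≡2s)
        (return-distance-of-2 Γ scm wdr (cong proj₁ ∂̃xy≡2s))
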